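{- Trivial fibrations are weak equivalences: every morphism of $\mathbf{rPres}$ having the right lifting property with respect to all morphisms of $\mathcal{I}$ belongs to $\mathcal{W}$.
   Context: $\mathbf{rPres}$ is the category of reflexive presentations of monoids (generators $P_1$, relations $P_2\subseteq P_1^*\times P_1^*$ containing $u\to u$ for every word; morphisms are maps on generators sending relations to relations). $\mathcal{W}$ is the class of morphisms $f:P\to Q$ such that the induced morphism $\overline{f}:\overline{P}\to\overline{Q}$ between presented monoids ($\overline{P}=P_1^*$ quotiented by the congruence generated by $P_2$) is an isomorphism. With $G$ the presentation with one generator and no relation, $G^n$ the one with $n$ generators and no relation, and $R^{m,n}$ the one with generators $a_1,\dots,a_{m+n}$ and relation $a_1\cdots a_m\to a_{m+1}\cdots a_{m+n}$, $\mathcal{I}$ is the class of inclusions $\emptyset\to G$ and $G^{m+n}\to R^{m,n}$. -}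

module Defs where

open import Data.Nat using (ℕ; _+_)
open import Data.Fin using (Fin; _↑ˡ_; _↑ʳ_)
open import Data.List using (List; []; map; _++_; allFin)
open import Data.Empty using (⊥)
open import Data.Sum using (_⊎_)
open import Data.Product using (Σ; _×_)
open import Relation.Binary.PropositionalEquality using (_≡_)

-- Reflexive presentation of a monoid: generators P₁, relations
-- P₂ ⊆ P₁* × P₁* (given as a predicate on pairs of words) containing
-- u → u for every word u.
record RPres : Set₁ where
  field
    Gen   : Set
    Rel   : List Gen → List Gen → Set
    rrefl : ∀ u → Rel u u
open RPres public

record Hom (P Q : RPres) : Set where
  field
    fun  : Gen P → Gen Q
    pres : ∀ {u v} → Rel P u v → Rel Q (map fun u) (map fun v)
open Hom public

data Cong (P : RPres) : List (Gen P) → List (Gen P) → Set where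
  gen   : ∀ {u v} → Rel P u v → Cong P u v
  crefl : ∀ {u} → Cong P u u
  csym  : ∀ {u v} → Cong P u v → Cong P v u
  ctrans : ∀ {u v w} → Cong P u v → Cong P v w → Cong P u w
  cctx  : ∀ {u v} (w w' : List (Gen P)) → Cong P u v →
          Cong P (w ++ (u ++ w')) (w ++ (v ++ w'))

-- The presented monoid P̄ = P₁* / Cong P is handled as a setoid.
-- f̄ : P̄ → Q̄ is induced by map (fun f).  f̄ is an isomorphism of monoids
-- iff there is an inverse monoid morphism ḡ : Q̄ → P̄, i.e. a map on words
-- respecting the congruences, preserving unit and product (up to the
-- congruence), and inverse to f̄ on both sides (up to the congruence).
record IsIsoBar {P Q : RPres} (f : Hom P Q) : Set where
  field
    inv       : List (Gen Q) → List (Gen P)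
    inv-resp  : ∀ {u v} → Cong Q u v → Cong P (inv u) (inv v)
    inv-unit  : Cong P (inv []) []
    inv-mult  : ∀ u v → Cong P (inv (u ++ v)) (inv u ++ inv v)
    inv-left  : ∀ u → Cong P (inv (map (fun f) u)) u
    inv-right : ∀ w → Cong Q (map (fun f) (inv w)) w

W : ∀ {P Q : RPres} → Hom P Q → Set
W f = IsIsoBar f

Empty : RPres
Empty = record { Gen = ⊥ ; Rel = _≡_ ; rrefl = λ u → _≡_.refl }

Gn : ℕ → RPres
Gn n = record { Gen = Fin n ; Rel = _≡_ ; rrefl = λ u → _≡_.refl }

G : RPres
G = Gn 1

-- R^{m,n}: generators a₁ … a_{m+n}, relation a₁⋯a_m → a_{m+1}⋯a_{m+n}
-- (plus the reflexive ones).
lhsR : (m n : ℕ) → List (Fin (m + n))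
lhsR m n = map (λ i → i ↑ˡ n) (allFin m)

rhsR : (m n : ℕ) → List (Fin (m + n))
rhsR m n = map (λ j → m ↑ʳ j) (allFin n)

Rmn : ℕ → ℕ → RPres
Rmn m n = record
  { Gen = Fin (m + n)
  ; Rel = λ u v → (u ≡ v) ⊎ ((u ≡ lhsR m n) × (v ≡ rhsR m n))
  ; rrefl = λ u → _⊎_.inj₁ _≡_.refl }

ι₀ : Hom Empty G
ι₀ = record { fun = λ () ; pres = λ { {[]} _≡_.refl → _≡_.refl } }

ιmn : (m n : ℕ) → Hom (Gn (m + n)) (Rmn m n)
ιmn m n = record { fun = λ x → x ; pres = λ e → _⊎_.inj₁ (congmap e) }
  where
  congmap : ∀ {u v : List (Fin (m + n))} → u ≡ v → map (λ x → x) u ≡ map (λ x → x) v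
  congmap _≡_.refl = _≡_.refl

-- Right lifting property of p : P → Q against i : A → B: for every
-- commutative square  p ∘ u = v ∘ i  there is h : B → P with h ∘ i = u and
-- p ∘ h = v.  (Equality of morphisms = equality of generator maps.)
RLP : ∀ {A B P Q : RPres} → Hom A B → Hom P Q → Set
RLP {A} {B} {P} {Q} i p =
  (u : Hom A P) (v : Hom B Q) →
  (∀ a → fun p (fun u a) ≡ fun v (fun i a)) →
  Σ (Hom B P) λ h →
    (∀ a → fun h (fun i a) ≡ fun u a) × (∀ b → fun p (fun h b) ≡ fun v b)

RLP-ℐ : ∀ {P Q : RPres} → Hom P Q → Set
RLP-ℐ p = RLP ι₀ p × (∀ m n → RLP (ιmn m n) p)

-- Lifting against ∅ → G yields, for every generator of Q, a preimage under
-- p, i.e. a section s of p on generators.  Lifting against G^{m+n} → R^{m,n},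
-- along the square that sends the generators to the letters of two words u
-- and u' whose images are related in Q, shows that p reflects relations.
-- Together these make the letterwise map s* : Q₁* → P₁* respect the
-- congruences, and it is inverse to p̄ because s(p a) and a become related
-- in P by reflecting the reflexive relation on p a.
module Submission where

open import Defs
open import Function using (id; _∘_)
open import Data.Nat using (_+_)
open import Data.Fin using (Fin; zero; splitAt)
open import Data.Fin.Properties using (splitAt-↑ˡ; splitAt-↑ʳ)
open import Data.List using (List; []; _∷_; map; _++_; allFin; tabulate; lookup; length)
open import Data.List.Properties
  using (map-∘; map-cong; map-tabulate; tabulate-cong; tabulate-lookup; map-++; ++-identityʳ)
open import Data.Sum using (inj₁; inj₂; [_,_])
open import Data.Product using (Σ; _,_; proj₁; proj₂)
open import Relation.Binary.PropositionalEquality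
  using (_≡_; _≗_; refl; sym; trans; cong; cong₂; subst₂; module ≡-Reasoning)

map-allFin-lookup : ∀ {A : Set} (ys : List A) {g : Fin (length ys) → A} →
                    g ≗ lookup ys → map g (allFin (length ys)) ≡ ys
map-allFin-lookup ys {g} g≗lookup = begin
  map g (allFin (length ys)) ≡⟨ map-tabulate id g ⟩
  tabulate g                 ≡⟨ tabulate-cong g≗lookup ⟩
  tabulate (lookup ys)       ≡⟨ tabulate-lookup ys ⟩
  ys                         ∎
  where open ≡-Reasoning

module _ {A : Set} (u u' : List A) where

  juxtapose : Fin (length u + length u') → A
  juxtapose = [ lookup u , lookup u' ] ∘ splitAt (length u)

  map-juxtapose-lhsR : map juxtapose (lhsR (length u) (length u')) ≡ u
  map-juxtapose-lhsR = trans (sym (map-∘ (allFin (length u))))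
    (map-allFin-lookup u λ i → cong [ lookup u , lookup u' ] (splitAt-↑ˡ (length u) i (length u')))

  map-juxtapose-rhsR : map juxtapose (rhsR (length u) (length u')) ≡ u'
  map-juxtapose-rhsR = trans (sym (map-∘ (allFin (length u'))))
    (map-allFin-lookup u' λ i → cong [ lookup u , lookup u' ] (splitAt-↑ʳ (length u) (length u') i))

≡⇒Rel : ∀ (P : RPres) {u v} → u ≡ v → Rel P u v
≡⇒Rel P {u} refl = rrefl P u

≡⇒Cong : ∀ {P : RPres} {u v} → u ≡ v → Cong P u v
≡⇒Cong refl = crefl

fromFree : ∀ {k} (P : RPres) → (Fin k → Gen P) → Hom (Gn k) P
fromFree P f = record { fun = f ; pres = ≡⇒Rel P ∘ cong (map f) }

Cong-++ : ∀ {P : RPres} {u u' v v'} → Cong P u u' → Cong P v v' → Cong P (u ++ v) (u' ++ v')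
Cong-++ {P} {u' = u'} {v} {v'} u~u' v~v' =
  ctrans (cctx [] v u~u')
         (subst₂ (λ x y → Cong P (u' ++ x) (u' ++ y)) (++-identityʳ v) (++-identityʳ v')
                 (cctx u' [] v~v'))

module _ {P Q : RPres} (p : Hom P Q) where

  RLP-ι₀⇒preimage : RLP ι₀ p → ∀ q → Σ (Gen P) λ a → fun p a ≡ q
  RLP-ι₀⇒preimage lifts q with lifts (record { fun = λ () ; pres = λ { {[]} refl → rrefl P [] } })
                                     (fromFree Q λ _ → q) (λ ())
  ... | h , _ , p∘h≗q = fun h zero , p∘h≗q zero

  relatedImages⇒Hom : ∀ u u' → Rel Q (map (fun p) u) (map (fun p) u') →
                      Hom (Rmn (length u) (length u')) Q
  relatedImages⇒Hom u u' pu~pu' = record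
    { fun  = fun p ∘ juxtapose u u'
    ; pres = λ { (inj₁ x≡y) → ≡⇒Rel Q (cong (map (fun p ∘ juxtapose u u')) x≡y)
               ; (inj₂ (refl , refl)) →
                   subst₂ (Rel Q) (sym (map-p∘ (map-juxtapose-lhsR u u')))
                                  (sym (map-p∘ (map-juxtapose-rhsR u u'))) pu~pu' } }
    where
    map-p∘ : ∀ {x w} → map (juxtapose u u') x ≡ w → map (fun p ∘ juxtapose u u') x ≡ map (fun p) w
    map-p∘ {x} refl = map-∘ x

  RLP-ιmn⇒reflects : (∀ m n → RLP (ιmn m n) p) →
                     ∀ u u' → Rel Q (map (fun p) u) (map (fun p) u') → Rel P u u'
  RLP-ιmn⇒reflects lifts u u' pu~pu'
    with lifts (length u) (length u') (fromFree P (juxtapose u u')) (relatedImages⇒Hom u u' pu~pu')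
               (λ _ → refl)
  ... | h , h≗juxtapose , _ =
    subst₂ (Rel P) (trans (map-cong h≗juxtapose _) (map-juxtapose-lhsR u u'))
                   (trans (map-cong h≗juxtapose _) (map-juxtapose-rhsR u u'))
           (pres h (inj₂ (refl , refl)))

module _ {P Q : RPres} (p : Hom P Q) (s : Gen Q → Gen P) (p∘s≗id : fun p ∘ s ≗ id)
         (reflects : ∀ u u' → Rel Q (map (fun p) u) (map (fun p) u') → Rel P u u') where

  map-p∘map-s : ∀ w → map (fun p) (map s w) ≡ w
  map-p∘map-s []      = refl
  map-p∘map-s (q ∷ w) = cong₂ _∷_ (p∘s≗id q) (map-p∘map-s w)

  map-s-resp : ∀ {u v} → Cong Q u v → Cong P (map s u) (map s v)
  map-s-resp {u} {v} (gen r) =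
    gen (reflects (map s u) (map s v) (subst₂ (Rel Q) (sym (map-p∘map-s u)) (sym (map-p∘map-s v)) r))
  map-s-resp crefl         = crefl
  map-s-resp (csym c)      = csym (map-s-resp c)
  map-s-resp (ctrans c d)  = ctrans (map-s-resp c) (map-s-resp d)
  map-s-resp (cctx w w' c) =
    subst₂ (Cong P) (sym (map-s-++₃ _)) (sym (map-s-++₃ _))
           (cctx (map s w) (map s w') (map-s-resp c))
    where
    map-s-++₃ : ∀ u → map s (w ++ (u ++ w')) ≡ map s w ++ (map s u ++ map s w')
    map-s-++₃ u = trans (map-++ s w (u ++ w')) (cong (map s w ++_) (map-++ s u w'))

  s∘p-letter : ∀ a → Cong P (s (fun p a) ∷ []) (a ∷ [])
  s∘p-letter a = gen (reflects (s (fun p a) ∷ []) (a ∷ [])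
                              (≡⇒Rel Q (cong (_∷ []) (p∘s≗id (fun p a)))))

  map-s∘map-p : ∀ u → Cong P (map s (map (fun p) u)) u
  map-s∘map-p []      = crefl
  map-s∘map-p (a ∷ u) = Cong-++ (s∘p-letter a) (map-s∘map-p u)

  reflecting-section⇒W : W p
  reflecting-section⇒W = record
    { inv       = map s
    ; inv-resp  = map-s-resp
    ; inv-unit  = crefl
    ; inv-mult  = λ u v → ≡⇒Cong (map-++ s u v)
    ; inv-left  = map-s∘map-p
    ; inv-right = ≡⇒Cong ∘ map-p∘map-s
    }

mainTheorem15 : (P Q : RPres) (p : Hom P Q) → RLP-ℐ p → W p
mainTheorem15 P Q p (lifts-ι₀ , lifts-ιmn) =
  reflecting-section⇒W p (proj₁ ∘ preimage) (proj₂ ∘ preimage) (RLP-ιmn⇒reflects p lifts-ιmn)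
  where
  preimage : ∀ q → Σ (Gen P) λ a → fun p a ≡ q
  preimage = RLP-ι₀⇒preimage p lifts-ι₀
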